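{- Let $(M,G,V,\mathcal{E})$ be a homogeneous factorisation of $K_n=(V,E)$ of index $k$, with $|V|=n$, $\mathcal{E}=\{E_1,\dots,E_k\}$ and factors $\Gamma_i=(V,E_i)$, such that $M$ is edge-transitive on each factor. Suppose $G$ is $2$-transitive on $V$ and $M$ (a transitive normal subgroup of $G$) has even order. Then: (1) all nontrivial $M$-orbitals in $V$ are self-paired and the number of nontrivial $M$-orbitals equals $k$; call them $\mathcal{O}_1,\dots,\mathcal{O}_k$. (2) The parts of $\mathcal{E}$ may be labelled so that $E_i=\{\{x,y\}:(x,y)\in\mathcal{O}_i\}$ for each $i$; moreover each factor $\Gamma_i$ is $M$-arc-transitive of valency $\frac{n-1}{k}$.
   Context: A homogeneous factorisation of index $k>1$ of $K_n=(V,E)$ ($E$ the set of 2-subsets of $V$) is a 4-tuple $(M,G,V,\mathcal{E})$ where $\mathcal{E}=\{E_1,\dots,E_k\}$ partitions $E$, $G\le\mathrm{Sym}(V)$ is transitive on $V$, leaves $\mathcal{E}$ invariant and permutes its parts transitively, and the kernel $M$ of this action is transitive on $V$. An $M$-orbital is an orbit of $M$ on $V\times V$; it is nontrivial if it is not the diagonal $\{(v,v)\}$, and an orbital $\mathcal{O}=(u,v)^M$ is self-paired if it equals $(v,u)^M$. -}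

module Defs where

open import Data.Nat using (ℕ; _<_; _*_; _∸_)
open import Data.Fin using (Fin)
open import Data.Fin.Properties using (_≟_)
open import Data.Vec using (Vec; lookup; tabulate; allFin)
open import Data.List using (List; length; filter)
import Data.List as List
open import Data.List.Membership.Propositional using (_∈_)
open import Data.List.Relation.Unary.Unique.Propositional using (Unique)
open import Data.Product using (Σ; ∃; _×_; _,_)
open import Data.Sum using (_⊎_)
open import Function.Definitions using (Injective)
open import Relation.Binary.PropositionalEquality using (_≡_; _≢_)
open import Relation.Nullary using (¬_)
open import Relation.Nullary.Decidable using (_×-dec_; ¬?)

-- The vertex set V is Fin n.  A map V → V is stored as the vector of its
-- images, so that equality of maps is decidable propositional equality.
Map : ℕ → Set
Map n = Vec (Fin n) n

act : ∀ {n} → Map n → Fin n → Fin n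
act g x = lookup g x

idMap : ∀ {n} → Map n
idMap {n} = allFin n

_∘ₘ_ : ∀ {n} → Map n → Map n → Map n
g ∘ₘ h = tabulate (λ x → act g (act h x))

-- A finite permutation group on Fin n, given as the duplicate-free list of
-- its elements (so its order is the length of the list).
record IsPermGroup (n : ℕ) (H : List (Map n)) : Set where
  field
    unique   : Unique H
    perm     : ∀ {g} → g ∈ H → Injective _≡_ _≡_ (act g)
    hasId    : idMap ∈ H
    closed∘  : ∀ {g h} → g ∈ H → h ∈ H → (g ∘ₘ h) ∈ H
    closedInv : ∀ {g} → g ∈ H → Σ (Map n) λ h → h ∈ H × (h ∘ₘ g ≡ idMap)

order : ∀ {n} → List (Map n) → ℕ
order H = length H

Transitive : ∀ {n} → List (Map n) → Set
Transitive {n} H = ∀ (x y : Fin n) → Σ (Map n) λ g → g ∈ H × act g x ≡ y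

TwoTransitive : ∀ {n} → List (Map n) → Set
TwoTransitive {n} H = ∀ (x y x' y' : Fin n) → x ≢ y → x' ≢ y' →
  Σ (Map n) λ g → g ∈ H × act g x ≡ x' × act g y ≡ y'

-- A partition E = {E_1,…,E_k} of the edges of K_n is given by a colouring
-- c : the edge {x,y} (x ≢ y) lies in E_(c x y).  Values on the diagonal are
-- irrelevant.
record IsEdgePartition (n k : ℕ) (c : Fin n → Fin n → Fin k) : Set where
  field
    symmetric : ∀ (x y : Fin n) → x ≢ y → c x y ≡ c y x
    onto      : ∀ (i : Fin k) → Σ (Fin n) λ x → Σ (Fin n) λ y → x ≢ y × c x y ≡ i

PreservesPartition : ∀ {n k} → (Fin n → Fin n → Fin k) → Map n → Set
PreservesPartition {n} {k} c g = Σ (Fin k → Fin k) λ σ →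
  ∀ (x y : Fin n) → x ≢ y → c (act g x) (act g y) ≡ σ (c x y)

FixesParts : ∀ {n k} → (Fin n → Fin n → Fin k) → Map n → Set
FixesParts {n} c g = ∀ (x y : Fin n) → x ≢ y → c (act g x) (act g y) ≡ c x y

record IsHomogeneousFactorisation (n k : ℕ) (M G : List (Map n))
       (c : Fin n → Fin n → Fin k) : Set where
  field
    indexGt1     : 1 < k
    partition    : IsEdgePartition n k c
    G-group      : IsPermGroup n G
    M-group      : IsPermGroup n M
    G-transitive : Transitive G
    G-preserves  : ∀ {g} → g ∈ G → PreservesPartition c g
    G-transOnParts : ∀ (i j : Fin k) → Σ (Map n) λ g → g ∈ G ×
                     (∀ (x y : Fin n) → x ≢ y → c x y ≡ i → c (act g x) (act g y) ≡ j)
    M-kernel₁    : ∀ {g} → g ∈ M → g ∈ G × FixesParts c g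
    M-kernel₂    : ∀ {g} → g ∈ G → FixesParts c g → g ∈ M
    M-transitive : Transitive M

EdgeTransitiveOnFactors : ∀ {n k} → List (Map n) → (Fin n → Fin n → Fin k) → Set
EdgeTransitiveOnFactors {n} M c = ∀ (x y x' y' : Fin n) → x ≢ y → x' ≢ y' →
  c x y ≡ c x' y' → Σ (Map n) λ g → g ∈ M ×
    ((act g x ≡ x' × act g y ≡ y') ⊎ (act g x ≡ y' × act g y ≡ x'))

SameOrbital : ∀ {n} → List (Map n) → Fin n × Fin n → Fin n × Fin n → Set
SameOrbital {n} M (x , y) (x' , y') = Σ (Map n) λ g → g ∈ M × act g x ≡ x' × act g y ≡ y'

SelfPaired : ∀ {n} → List (Map n) → Fin n × Fin n → Set
SelfPaired M (x , y) = SameOrbital M (x , y) (y , x)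

Nontrivial : ∀ {n} → Fin n × Fin n → Set
Nontrivial (x , y) = x ≢ y

-- Representatives r 1,…,r k of the nontrivial M-orbitals: each nontrivial,
-- pairwise in distinct orbitals, and every nontrivial pair lies in the orbital
-- of some r i.  (So the number of nontrivial M-orbitals is k.)
OrbitalTransversal : ∀ {n k} → List (Map n) → (Fin k → Fin n × Fin n) → Set
OrbitalTransversal {n} {k} M r =
  (∀ i → Nontrivial (r i)) ×
  (∀ i j → SameOrbital M (r i) (r j) → i ≡ j) ×
  (∀ (p : Fin n × Fin n) → Nontrivial p → Σ (Fin k) λ i → SameOrbital M (r i) p)

valency : ∀ {n k} → (Fin n → Fin n → Fin k) → Fin k → Fin n → ℕ
valency {n} c i x =
  length (filter (λ y → ¬? (x ≟ y) ×-dec (c x y Data.Fin.≟ i)) (List.allFin n))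

ArcTransitive : ∀ {n k} → List (Map n) → (Fin n → Fin n → Fin k) → Fin k → Set
ArcTransitive {n} M c i = ∀ (x y x' y' : Fin n) → x ≢ y → x' ≢ y' →
  c x y ≡ i → c x' y' ≡ i → SameOrbital M (x , y) (x' , y')

-- As |M| is even, Cauchy's argument (pair each non-identity element with its inverse) gives an
-- involution t ∈ M, which swaps some pair x₀, t x₀.  Since the kernel M is normal
-- in the 2-transitive group G, the conjugates of t swap every pair, so every nontrivial M-orbital
-- is self-paired.  M fixes the colours, and edge-transitivity together with these swaps makes each
-- colour class a single orbital: colours and nontrivial orbitals correspond.  Finally G maps
-- neighbourhoods in one factor onto neighbourhoods in another while permuting the factors
-- transitively, so all factors are regular of a common valency d, and counting the n ∸ 1
-- neighbours of a vertex by colour gives d k = n ∸ 1.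
module Submission where

open import Defs
open import Data.Nat using (ℕ; zero; suc; _+_; _*_; _∸_; _≤_; s≤s)
open import Data.Nat.Properties using (+-0-commutativeMonoid; +-comm; *-comm; ≤-refl; ≤-trans; n≤1+n)
open import Data.Nat.Divisibility using (_∣_; _∣0; ∣-refl; ∣m∣n⇒∣m+n; ∣m+n∣m⇒∣n; ∣1⇒≡1)
open import Algebra.Properties.CommutativeMonoid.Sum +-0-commutativeMonoid
  using (sum-syntax; sum-cong-≗; sum-remove; sum-permute; ∑-comm)
open import Data.Bool using (if_then_else_)
open import Data.Fin using (Fin; zero; suc; punchIn)
open import Data.Fin.Properties using (_≟_; ¬∀⟶∃¬; punchInᵢ≢i)
open import Data.Fin.Permutation using (Permutation′; permutation; _⟨$⟩ʳ_)
import Data.Vec as Vec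
open import Data.Vec.Properties using (lookup∘tabulate; tabulate∘lookup; tabulate-cong; lookup-allFin; ≡-dec)
open import Data.List using (List; []; _∷_; length; filter; tabulate)
open import Data.List.Properties using (filter-accept; filter-reject; filter-all)
open import Data.List.Membership.Propositional using (_∈_; find; lose)
open import Data.List.Membership.Propositional.Properties using (∈-filter⁺; ∈-filter⁻)
open import Data.List.Relation.Unary.Any using (here; there; any?)
import Data.List.Relation.Unary.All as All
open import Data.List.Relation.Unary.AllPairs using (_∷_)
open import Data.List.Relation.Unary.Unique.Propositional using (Unique)
open import Data.List.Relation.Unary.Unique.Propositional.Properties using (filter⁺)
open import Level using (_⊔_)
open import Data.Empty using (⊥-elim)
open import Data.Product using (Σ; ∃-syntax; _×_; _,_; proj₁; proj₂)
open import Data.Sum using (inj₁; inj₂)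
open import Function using (_∘_; id; _⇔_; mk⇔)
open import Relation.Binary.Definitions using (DecidableEquality)
open import Relation.Binary.PropositionalEquality
  using (_≡_; _≢_; refl; sym; trans; subst; cong; cong₂; ≢-sym; module ≡-Reasoning)
open import Relation.Nullary using (¬_; Dec; does; yes; no)
open import Relation.Nullary.Decidable using (¬?; _×-dec_; dec-true; dec-false; does-⇔)
open import Relation.Unary using (Pred; Decidable)

open ≡-Reasoning

act-∘ : ∀ {n} (g h : Map n) x → act (g ∘ₘ h) x ≡ act g (act h x)
act-∘ g h = lookup∘tabulate _

act-∘∘ : ∀ {n} (g t h : Map n) x → act (g ∘ₘ (t ∘ₘ h)) x ≡ act g (act t (act h x))
act-∘∘ g t h x = trans (act-∘ g (t ∘ₘ h) x) (cong (act g) (act-∘ t h x))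

act-id : ∀ {n} (x : Fin n) → act idMap x ≡ x
act-id = lookup-allFin

Map-ext : ∀ {n} {g h : Map n} → (∀ x → act g x ≡ act h x) → g ≡ h
Map-ext {g = g} {h} g≗h = begin
  g                    ≡⟨ tabulate∘lookup g ⟨
  Vec.tabulate (act g) ≡⟨ tabulate-cong g≗h ⟩
  Vec.tabulate (act h) ≡⟨ tabulate∘lookup h ⟩
  h                    ∎

infix 4 _≟ₘ_
_≟ₘ_ : ∀ {n} → DecidableEquality (Map n)
_≟ₘ_ = ≡-dec _≟_

id-∘ : ∀ {n} (g : Map n) → idMap ∘ₘ g ≡ g
id-∘ g = Map-ext λ x → trans (act-∘ idMap g x) (act-id (act g x))

∘≡id⇒inverse : ∀ {n} (h g : Map n) → h ∘ₘ g ≡ idMap → ∀ x → act h (act g x) ≡ x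
∘≡id⇒inverse h g hg≡id x = begin
  act h (act g x)    ≡⟨ act-∘ h g x ⟨
  act (h ∘ₘ g) x     ≡⟨ cong (λ f → act f x) hg≡id ⟩
  act idMap x        ≡⟨ act-id x ⟩
  x                  ∎

PerfectlyMatched : ∀ {a r} {A : Set a} → (A → A → Set r) → List A → Set (a ⊔ r)
PerfectlyMatched R xs = ∀ {x} → x ∈ xs → ∃[ y ] y ∈ xs × R x y

module _ {a} {A : Set a} (_≟ᴬ_ : DecidableEquality A) where

  remove : A → List A → List A
  remove y = filter (λ z → ¬? (z ≟ᴬ y))

  length-remove : ∀ {y xs} → Unique xs → y ∈ xs → length xs ≡ suc (length (remove y xs))
  length-remove {xs = x ∷ xs} (x∉xs ∷ _) (here refl)
    rewrite filter-reject (λ z → ¬? (z ≟ᴬ x)) {x} {xs} (λ x≢x → x≢x refl)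
          | filter-all (λ z → ¬? (z ≟ᴬ x)) (All.map ≢-sym x∉xs) = refl
  length-remove {y} {x ∷ xs} (x∉xs ∷ xs-unique) (there y∈xs)
    rewrite filter-accept (λ z → ¬? (z ≟ᴬ y)) {x} {xs} (All.lookup x∉xs y∈xs) =
    cong suc (length-remove xs-unique y∈xs)

  module _ {r} (R : A → A → Set r)
           (R-sym : ∀ {x y} → R x y → R y x)
           (R-functional : ∀ {x y z} → R x y → R x z → y ≡ z)
           (R-irreflexive : ∀ {x y} → R x y → x ≢ y) where

    2∣length-perfectlyMatched : ∀ xs → Unique xs → PerfectlyMatched R xs → 2 ∣ length xs
    2∣length-perfectlyMatched xs = go (length xs) xs ≤-refl
      where
      go : ∀ m xs → length xs ≤ m → Unique xs → PerfectlyMatched R xs → 2 ∣ length xs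
      go _ [] _ _ _ = 2 ∣0
      go (suc m) (a ∷ xs) (s≤s |xs|≤m) (a∉xs ∷ xs-unique) matched with matched (here refl)
      ... | _ , here refl , Raa = ⊥-elim (R-irreflexive Raa refl)
      ... | b , there b∈xs , Rab =
        subst (2 ∣_) (cong suc (sym |xs|≡1+|xs'|))
              (∣m∣n⇒∣m+n ∣-refl (go m xs' |xs'|≤m (filter⁺ _ xs-unique) xs'-matched))
        where
        xs' = remove b xs
        |xs|≡1+|xs'| : length xs ≡ suc (length xs')
        |xs|≡1+|xs'| = length-remove xs-unique b∈xs
        |xs'|≤m : length xs' ≤ m
        |xs'|≤m = ≤-trans (n≤1+n _) (subst (_≤ m) |xs|≡1+|xs'| |xs|≤m)
        -- the partner of any other element is neither a nor b, so it survives the removal of b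
        xs'-matched : PerfectlyMatched R xs'
        xs'-matched {x} x∈xs' with ∈-filter⁻ (λ z → ¬? (z ≟ᴬ b)) {x} {xs} x∈xs'
        ... | x∈xs , x≢b with matched (there x∈xs)
        ... | _ , here refl , Rxa = ⊥-elim (x≢b (R-functional (R-sym Rxa) Rab))
        ... | y , there y∈xs , Rxy =
          y , ∈-filter⁺ (λ z → ¬? (z ≟ᴬ b)) y∈xs y≢b , Rxy
          where
          y≢b : y ≢ b
          y≢b refl = All.lookup a∉xs x∈xs (R-functional (R-sym Rab) (R-sym Rxy))

module PermGroup {n} {H : List (Map n)} (H-group : IsPermGroup n H) where
  open IsPermGroup H-group public

  act-≢ : ∀ {g x y} → g ∈ H → x ≢ y → act g x ≢ act g y
  act-≢ g∈H x≢y = x≢y ∘ perm g∈H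

  ∘≡id-comm : ∀ g {h} → h ∈ H → h ∘ₘ g ≡ idMap → g ∘ₘ h ≡ idMap
  ∘≡id-comm g {h} h∈H hg≡id = Map-ext λ x → begin
    act (g ∘ₘ h) x      ≡⟨ act-∘ g h x ⟩
    act g (act h x)     ≡⟨ perm h∈H (∘≡id⇒inverse h g hg≡id (act h x)) ⟩
    x                   ≡⟨ act-id x ⟨
    act idMap x         ∎

  left-inverse-unique : ∀ g {h h′} → h′ ∈ H → h ∘ₘ g ≡ idMap → h′ ∘ₘ g ≡ idMap → h ≡ h′
  left-inverse-unique g {h} {h′} h′∈H hg≡id h′g≡id = Map-ext λ x → begin
    act h x                    ≡⟨ cong (act h) (∘≡id⇒inverse g h′ (∘≡id-comm g h′∈H h′g≡id) x) ⟨
    act h (act g (act h′ x))   ≡⟨ ∘≡id⇒inverse h g hg≡id (act h′ x) ⟩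
    act h′ x                   ∎

  inv : ∀ {g} → g ∈ H → Map n
  inv g∈H = proj₁ (closedInv g∈H)

  inv-∈ : ∀ {g} (g∈H : g ∈ H) → inv g∈H ∈ H
  inv-∈ g∈H = proj₁ (proj₂ (closedInv g∈H))

  inv-∘ : ∀ {g} (g∈H : g ∈ H) → inv g∈H ∘ₘ g ≡ idMap
  inv-∘ g∈H = proj₂ (proj₂ (closedInv g∈H))

  inv-act : ∀ {g} (g∈H : g ∈ H) x → act (inv g∈H) (act g x) ≡ x
  inv-act {g} g∈H = ∘≡id⇒inverse (inv g∈H) g (inv-∘ g∈H)

  act-inv : ∀ {g} (g∈H : g ∈ H) x → act g (act (inv g∈H) x) ≡ x
  act-inv {g} g∈H = ∘≡id⇒inverse g (inv g∈H) (∘≡id-comm g (inv-∈ g∈H) (inv-∘ g∈H))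

  permutationOf : ∀ {g} → g ∈ H → Permutation′ n
  permutationOf {g} g∈H = permutation (act g) (act (inv g∈H)) (act-inv g∈H) (inv-act g∈H)

  IsInvolution : Map n → Set
  IsInvolution t = t ∘ₘ t ≡ idMap × t ≢ idMap

  private
    AreInverse : Map n → Map n → Set
    AreInverse g h = g ∈ H × h ∈ H × g ≢ idMap × h ∘ₘ g ≡ idMap

  2∣order-nonidentity : (∀ {t} → t ∈ H → ¬ IsInvolution t) → 2 ∣ length (remove _≟ₘ_ idMap H)
  2∣order-nonidentity noInvolution =
    2∣length-perfectlyMatched _≟ₘ_ AreInverse symmetric functional irreflexive _ (filter⁺ _ unique) matched
    where
    symmetric : ∀ {g h} → AreInverse g h → AreInverse h g
    symmetric {g} (g∈H , h∈H , g≢id , hg≡id) =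
      h∈H , g∈H , (λ { refl → g≢id (trans (sym (id-∘ g)) hg≡id) }) , ∘≡id-comm g h∈H hg≡id
    functional : ∀ {g h h′} → AreInverse g h → AreInverse g h′ → h ≡ h′
    functional {g} (_ , _ , _ , hg≡id) (_ , h′∈H , _ , h′g≡id) = left-inverse-unique g h′∈H hg≡id h′g≡id
    irreflexive : ∀ {g h} → AreInverse g h → g ≢ h
    irreflexive (g∈H , _ , g≢id , gg≡id) refl = noInvolution g∈H (gg≡id , g≢id)
    matched : PerfectlyMatched AreInverse (remove _≟ₘ_ idMap H)
    matched {g} g∈H∖id with ∈-filter⁻ (λ z → ¬? (z ≟ₘ idMap)) {g} g∈H∖id
    ... | g∈H , g≢id = inv g∈H , ∈-filter⁺ _ (inv-∈ g∈H) inv≢id , g-inv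
      where
      g-inv : AreInverse g (inv g∈H)
      g-inv = g∈H , inv-∈ g∈H , g≢id , inv-∘ g∈H
      inv≢id : inv g∈H ≢ idMap
      inv≢id = proj₁ (proj₂ (proj₂ (symmetric g-inv)))

  -- Cauchy's theorem for the prime 2: without involutions, inversion pairs off the non-identity elements
  involution-of-even-order : 2 ∣ order H → ∃[ t ] t ∈ H × IsInvolution t
  involution-of-even-order 2∣|H|
    with any? (λ t → (t ∘ₘ t ≟ₘ idMap) ×-dec ¬? (t ≟ₘ idMap)) H
  ... | yes someInvolution = find someInvolution
  ... | no noInvolution = ⊥-elim (2≢1 (∣1⇒≡1 2∣1))
    where
    2∣1+|H∖id| : 2 ∣ length (remove _≟ₘ_ idMap H) + 1
    2∣1+|H∖id| = subst (2 ∣_) (trans (length-remove _≟ₘ_ unique hasId) (+-comm 1 _)) 2∣|H|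
    2∣1 : 2 ∣ 1
    2∣1 = ∣m+n∣m⇒∣n 2∣1+|H∖id| (2∣order-nonidentity (λ t∈H → noInvolution ∘ lose t∈H))
    2≢1 : 2 ≢ 1
    2≢1 ()

  moved-point : ∀ {g} → g ≢ idMap → ∃[ x ] act g x ≢ x
  moved-point {g} g≢id =
    ¬∀⟶∃¬ n (λ x → act g x ≡ x) (λ x → act g x ≟ x) λ fixesAll →
      g≢id (Map-ext λ x → trans (fixesAll x) (sym (act-id x)))

𝟙 : ∀ {p} {P : Set p} → Dec P → ℕ
𝟙 P? = if does P? then 1 else 0

𝟙-⇔ : ∀ {p q} {P : Set p} {Q : Set q} → P ⇔ Q → (P? : Dec P) (Q? : Dec Q) → 𝟙 P? ≡ 𝟙 Q?
𝟙-⇔ P⇔Q P? Q? = cong (λ b → if b then 1 else 0) (does-⇔ P⇔Q P? Q?)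

𝟙-yes : ∀ {p} {P : Set p} (P? : Dec P) → P → 𝟙 P? ≡ 1
𝟙-yes P? p = cong (λ b → if b then 1 else 0) (dec-true P? p)

𝟙-no : ∀ {p} {P : Set p} (P? : Dec P) → ¬ P → 𝟙 P? ≡ 0
𝟙-no P? ¬p = cong (λ b → if b then 1 else 0) (dec-false P? ¬p)

count : ∀ {n p} {P : Pred (Fin n) p} → Decidable P → ℕ
count {n} P? = ∑[ y < n ] 𝟙 (P? y)

length-filter-tabulate : ∀ {n a p} {A : Set a} {P : Pred A p} (P? : Decidable P) (f : Fin n → A) →
                         length (filter P? (tabulate f)) ≡ count (P? ∘ f)
length-filter-tabulate {zero}  P? f = refl
length-filter-tabulate {suc n} P? f with P? (f zero)
... | yes _ = cong suc (length-filter-tabulate P? (f ∘ suc))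
... | no  _ = length-filter-tabulate P? (f ∘ suc)

count-cong : ∀ {n p q} {P : Pred (Fin n) p} {Q : Pred (Fin n) q} (P? : Decidable P) (Q? : Decidable Q) →
             (∀ y → P y ⇔ Q y) → count P? ≡ count Q?
count-cong P? Q? P⇔Q = sum-cong-≗ λ y → 𝟙-⇔ (P⇔Q y) (P? y) (Q? y)

count-permute : ∀ {n p q} {P : Pred (Fin n) p} {Q : Pred (Fin n) q} (P? : Decidable P) (Q? : Decidable Q) →
                (π : Permutation′ n) → (∀ y → P y ⇔ Q (π ⟨$⟩ʳ y)) → count P? ≡ count Q?
count-permute P? Q? π P⇔Qπ = trans (count-cong P? (Q? ∘ (π ⟨$⟩ʳ_)) P⇔Qπ) (sym (sum-permute _ π))

count-all : ∀ {n p} {P : Pred (Fin n) p} (P? : Decidable P) → (∀ y → P y) → count P? ≡ n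
count-all {zero}  P? all = refl
count-all {suc n} P? all = cong₂ _+_ (𝟙-yes (P? zero) (all zero)) (count-all (P? ∘ suc) (all ∘ suc))

count-none : ∀ {n p} {P : Pred (Fin n) p} (P? : Decidable P) → (∀ y → ¬ P y) → count P? ≡ 0
count-none {zero}  P? none = refl
count-none {suc n} P? none = cong₂ _+_ (𝟙-no (P? zero) (none zero)) (count-none (P? ∘ suc) (none ∘ suc))

count-≡ : ∀ {n} (a : Fin n) → count (a ≟_) ≡ 1
count-≡ {suc n} a = begin
  count (a ≟_)                                  ≡⟨ sum-remove {i = a} (𝟙 ∘ (a ≟_)) ⟩
  𝟙 (a ≟ a) + count (λ j → a ≟ punchIn a j)     ≡⟨ cong₂ _+_ (𝟙-yes (a ≟ a) refl) none ⟩
  1                                             ∎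
  where
  none : count (λ j → a ≟ punchIn a j) ≡ 0
  none = count-none (λ j → a ≟ punchIn a j) λ j → punchInᵢ≢i a j ∘ sym

count-≢ : ∀ {n} (a : Fin n) → count (λ y → ¬? (a ≟ y)) ≡ n ∸ 1
count-≢ {suc n} a = begin
  count (λ y → ¬? (a ≟ y))                              ≡⟨ sum-remove {i = a} (𝟙 ∘ λ y → ¬? (a ≟ y)) ⟩
  𝟙 (¬? (a ≟ a)) + count (λ j → ¬? (a ≟ punchIn a j))   ≡⟨ cong₂ _+_ (𝟙-no (¬? (a ≟ a)) (λ a≢a → a≢a refl)) all ⟩
  n                                                     ∎
  where
  all : count (λ j → ¬? (a ≟ punchIn a j)) ≡ n
  all = count-all (λ j → ¬? (a ≟ punchIn a j)) λ j → punchInᵢ≢i a j ∘ sym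

count-×-≡ : ∀ {n p} {P : Set p} (P? : Dec P) (a : Fin n) → count (λ i → P? ×-dec (a ≟ i)) ≡ 𝟙 P?
count-×-≡ P? a with P?
... | yes p = trans (count-cong (λ i → yes p ×-dec (a ≟ i)) (a ≟_) λ _ → mk⇔ proj₂ (p ,_)) (count-≡ a)
... | no ¬p = count-none (λ i → no ¬p ×-dec (a ≟ i)) λ _ → ¬p ∘ proj₁

∑-const : ∀ n d → ∑[ i < n ] d ≡ n * d
∑-const zero    d = refl
∑-const (suc n) d = cong (d +_) (∑-const n d)

adjacent? : ∀ {n k} (c : Fin n → Fin n → Fin k) i x → Decidable (λ y → x ≢ y × c x y ≡ i)
adjacent? c i x y = ¬? (x ≟ y) ×-dec (c x y ≟ i)

valency≡count : ∀ {n k} (c : Fin n → Fin n → Fin k) i x → valency c i x ≡ count (adjacent? c i x)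
valency≡count c i x = length-filter-tabulate (adjacent? c i x) id

module HomogeneousFactorisation {n k} {M G : List (Map n)} {c : Fin n → Fin n → Fin k}
       (hf : IsHomogeneousFactorisation n k M G c) where
  open IsHomogeneousFactorisation hf
  open IsEdgePartition partition
  module G = PermGroup G-group
  module M = PermGroup M-group

  M⊆G : ∀ {g} → g ∈ M → g ∈ G
  M⊆G = proj₁ ∘ M-kernel₁

  M-fixesParts : ∀ {g} → g ∈ M → FixesParts c g
  M-fixesParts = proj₂ ∘ M-kernel₁

  colour-preserved : ∀ {g x y a b} → g ∈ G → x ≢ y → a ≢ b →
                     c x y ≡ c a b → c (act g x) (act g y) ≡ c (act g a) (act g b)
  colour-preserved {g} {x} {y} {a} {b} g∈G x≢y a≢b cxy≡cab with G-preserves g∈G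
  ... | σ , σ-spec = begin
    c (act g x) (act g y)   ≡⟨ σ-spec x y x≢y ⟩
    σ (c x y)               ≡⟨ cong σ cxy≡cab ⟩
    σ (c a b)               ≡⟨ σ-spec a b a≢b ⟨
    c (act g a) (act g b)   ∎

  colour-reflected : ∀ {g x y a b} → g ∈ G → x ≢ y → a ≢ b →
                     c (act g x) (act g y) ≡ c (act g a) (act g b) → c x y ≡ c a b
  colour-reflected {g} {x} {y} {a} {b} g∈G x≢y a≢b cgxgy≡cgagb = begin
    c x y                          ≡⟨ cong₂ c (G.inv-act g∈G x) (G.inv-act g∈G y) ⟨
    c (act h (act g x)) (act h (act g y))
      ≡⟨ colour-preserved (G.inv-∈ g∈G) (G.act-≢ g∈G x≢y) (G.act-≢ g∈G a≢b) cgxgy≡cgagb ⟩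
    c (act h (act g a)) (act h (act g b))
      ≡⟨ cong₂ c (G.inv-act g∈G a) (G.inv-act g∈G b) ⟩
    c a b                          ∎
    where h = G.inv g∈G

  conjugate-∈ : ∀ {g t} (g∈G : g ∈ G) → t ∈ M → g ∘ₘ (t ∘ₘ G.inv g∈G) ∈ M
  conjugate-∈ {g} {t} g∈G t∈M = M-kernel₂ (G.closed∘ g∈G (G.closed∘ (M⊆G t∈M) (G.inv-∈ g∈G))) fixes
    where
    h = G.inv g∈G
    fixes : FixesParts c (g ∘ₘ (t ∘ₘ h))
    fixes x y x≢y = begin
      c (act (g ∘ₘ (t ∘ₘ h)) x) (act (g ∘ₘ (t ∘ₘ h)) y)   ≡⟨ cong₂ c (act-∘∘ g t h x) (act-∘∘ g t h y) ⟩
      c (act g (act t (act h x))) (act g (act t (act h y)))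
        ≡⟨ colour-preserved g∈G (M.act-≢ t∈M hx≢hy) hx≢hy (M-fixesParts t∈M _ _ hx≢hy) ⟩
      c (act g (act h x)) (act g (act h y))                 ≡⟨ cong₂ c (G.act-inv g∈G x) (G.act-inv g∈G y) ⟩
      c x y                                                 ∎
      where hx≢hy = G.act-≢ (G.inv-∈ g∈G) x≢y

  swap⇒allSelfPaired : TwoTransitive G → ∀ {t x₀ y₀} → t ∈ M → x₀ ≢ y₀ → act t x₀ ≡ y₀ → act t y₀ ≡ x₀ →
                       ∀ x y → x ≢ y → SelfPaired M (x , y)
  swap⇒allSelfPaired 2-trans {t} {x₀} {y₀} t∈M x₀≢y₀ tx₀≡y₀ ty₀≡x₀ x y x≢y
    with 2-trans x₀ y₀ x y x₀≢y₀ x≢y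
  ... | g , g∈G , gx₀≡x , gy₀≡y =
    g ∘ₘ (t ∘ₘ h) , conjugate-∈ g∈G t∈M , swaps x₀ y₀ gx₀≡x gy₀≡y tx₀≡y₀ , swaps y₀ x₀ gy₀≡y gx₀≡x ty₀≡x₀
    where
    h = G.inv g∈G
    swaps : ∀ u v {x y} → act g u ≡ x → act g v ≡ y → act t u ≡ v → act (g ∘ₘ (t ∘ₘ h)) x ≡ y
    swaps u v {x} {y} gu≡x gv≡y tu≡v = begin
      act (g ∘ₘ (t ∘ₘ h)) x       ≡⟨ act-∘∘ g t h x ⟩
      act g (act t (act h x))     ≡⟨ cong (act g ∘ act t) (trans (cong (act h) (sym gu≡x)) (G.inv-act g∈G u)) ⟩
      act g (act t u)             ≡⟨ cong (act g) tu≡v ⟩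
      act g v                     ≡⟨ gv≡y ⟩
      y                           ∎

  evenOrder⇒allSelfPaired : TwoTransitive G → 2 ∣ order M → ∀ x y → x ≢ y → SelfPaired M (x , y)
  evenOrder⇒allSelfPaired 2-trans 2∣|M| with M.involution-of-even-order 2∣|M|
  ... | t , t∈M , tt≡id , t≢id with M.moved-point t≢id
  ... | x₀ , tx₀≢x₀ =
    swap⇒allSelfPaired 2-trans t∈M (≢-sym tx₀≢x₀) refl (∘≡id⇒inverse t t tt≡id x₀)

  colour : Fin n × Fin n → Fin k
  colour (x , y) = c x y

  colour-orbitalInvariant : ∀ {x y x′ y′} → x ≢ y → SameOrbital M (x , y) (x′ , y′) → c x′ y′ ≡ c x y
  colour-orbitalInvariant {x} {y} x≢y (g , g∈M , gx≡x′ , gy≡y′) =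
    trans (cong₂ c (sym gx≡x′) (sym gy≡y′)) (M-fixesParts g∈M x y x≢y)

  sameOrbital-trans : ∀ {p q r} → SameOrbital M p q → SameOrbital M q r → SameOrbital M p r
  sameOrbital-trans {x , y} (g , g∈M , gx≡x′ , gy≡y′) (h , h∈M , hx′≡x″ , hy′≡y″) =
    h ∘ₘ g , M.closed∘ h∈M g∈M ,
    trans (act-∘ h g x) (trans (cong (act h) gx≡x′) hx′≡x″) ,
    trans (act-∘ h g y) (trans (cong (act h) gy≡y′) hy′≡y″)

  representative : Fin k → Fin n × Fin n
  representative i = proj₁ (onto i) , proj₁ (proj₂ (onto i))

  representative-nontrivial : ∀ i → Nontrivial (representative i)
  representative-nontrivial i = proj₁ (proj₂ (proj₂ (onto i)))

  colour-representative : ∀ i → colour (representative i) ≡ i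
  colour-representative i = proj₂ (proj₂ (proj₂ (onto i)))

  module _ (edgeTrans : EdgeTransitiveOnFactors M c) (allSelfPaired : ∀ x y → x ≢ y → SelfPaired M (x , y)) where

    -- M swaps the ends of every edge, so edge-transitivity upgrades to arc-transitivity
    sameColour⇒sameOrbital : ∀ {x y x′ y′} → x ≢ y → x′ ≢ y′ → c x y ≡ c x′ y′ → SameOrbital M (x , y) (x′ , y′)
    sameColour⇒sameOrbital {x} {y} {x′} {y′} x≢y x′≢y′ cxy≡cx′y′
      with edgeTrans x y x′ y′ x≢y x′≢y′ cxy≡cx′y′
    ... | g , g∈M , inj₁ (gx≡x′ , gy≡y′) = g , g∈M , gx≡x′ , gy≡y′
    ... | g , g∈M , inj₂ (gx≡y′ , gy≡x′) =
      sameOrbital-trans (g , g∈M , gx≡y′ , gy≡x′) (allSelfPaired y′ x′ (≢-sym x′≢y′))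

    colour≡⇒sameOrbital : ∀ {x y} i → x ≢ y → c x y ≡ i → SameOrbital M (representative i) (x , y)
    colour≡⇒sameOrbital i x≢y cxy≡i =
      sameColour⇒sameOrbital (representative-nontrivial i) x≢y
        (trans (colour-representative i) (sym cxy≡i))

    sameOrbital⇒colour≡ : ∀ {x y} i → SameOrbital M (representative i) (x , y) → c x y ≡ i
    sameOrbital⇒colour≡ i same =
      trans (colour-orbitalInvariant (representative-nontrivial i) same) (colour-representative i)

    orbitalTransversal : OrbitalTransversal M representative
    orbitalTransversal =
      representative-nontrivial ,
      (λ i j same → trans (sym (sameOrbital⇒colour≡ i same)) (colour-representative j)) ,
      λ { (x , y) x≢y → c x y , colour≡⇒sameOrbital (c x y) x≢y refl }

    arcTransitive : ∀ i → ArcTransitive M c i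
    arcTransitive i x y x′ y′ x≢y x′≢y′ cxy≡i cx′y′≡i =
      sameColour⇒sameOrbital x≢y x′≢y′ (trans cxy≡i (sym cx′y′≡i))

  valency-act : ∀ {g a b} x → g ∈ G → a ≢ b →
                valency c (c a b) x ≡ valency c (c (act g a) (act g b)) (act g x)
  valency-act {g} {a} {b} x g∈G a≢b = begin
    valency c (c a b) x                                        ≡⟨ valency≡count c _ x ⟩
    count (adjacent? c (c a b) x)
      ≡⟨ count-permute (adjacent? c _ x) (adjacent? c _ (act g x)) (G.permutationOf g∈G) (λ _ → mk⇔ forth back) ⟩
    count (adjacent? c (c (act g a) (act g b)) (act g x))
      ≡⟨ valency≡count c _ (act g x) ⟨
    valency c (c (act g a) (act g b)) (act g x)                ∎
    where
    forth : ∀ {y} → x ≢ y × c x y ≡ c a b →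
            act g x ≢ act g y × c (act g x) (act g y) ≡ c (act g a) (act g b)
    forth (x≢y , cxy≡cab) = G.act-≢ g∈G x≢y , colour-preserved g∈G x≢y a≢b cxy≡cab
    back : ∀ {y} → act g x ≢ act g y × c (act g x) (act g y) ≡ c (act g a) (act g b) →
           x ≢ y × c x y ≡ c a b
    back (gx≢gy , cgxgy≡cgagb) = x≢y , colour-reflected g∈G x≢y a≢b cgxgy≡cgagb
      where x≢y = gx≢gy ∘ cong (act g)

  valency-vertexIndependent : ∀ i x x′ → valency c i x ≡ valency c i x′
  valency-vertexIndependent i x x′ with onto i | M-transitive x x′
  ... | a , b , a≢b , refl | m , m∈M , mx≡x′ =
    trans (valency-act x (M⊆G m∈M) a≢b) (cong₂ (valency c) (M-fixesParts m∈M a b a≢b) mx≡x′)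

  valency-colourIndependent : ∀ i j x → valency c i x ≡ valency c j x
  valency-colourIndependent i j x with onto i
  ... | a , b , a≢b , refl with G-transOnParts (c a b) j
  ... | g , g∈G , i↦j = begin
    valency c (c a b) x                            ≡⟨ valency-act x g∈G a≢b ⟩
    valency c (c (act g a) (act g b)) (act g x)    ≡⟨ cong (λ i → valency c i (act g x)) (i↦j a b a≢b refl) ⟩
    valency c j (act g x)                          ≡⟨ valency-vertexIndependent j (act g x) x ⟩
    valency c j x                                  ∎

  ∑-valency : ∀ x → ∑[ i < k ] valency c i x ≡ n ∸ 1
  ∑-valency x = begin
    ∑[ i < k ] valency c i x                                  ≡⟨ sum-cong-≗ (λ i → valency≡count c i x) ⟩
    ∑[ i < k ] ∑[ y < n ] 𝟙 (adjacent? c i x y)     ≡⟨ ∑-comm (λ i y → 𝟙 (adjacent? c i x y)) ⟩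
    ∑[ y < n ] ∑[ i < k ] 𝟙 (adjacent? c i x y)     ≡⟨ sum-cong-≗ (λ y → count-×-≡ (¬? (x ≟ y)) (c x y)) ⟩
    count (λ y → ¬? (x ≟ y))                                  ≡⟨ count-≢ x ⟩
    n ∸ 1                                                     ∎

  factors-regular : ∀ i → Σ ℕ λ d → (d * k ≡ n ∸ 1) × (∀ x → valency c i x ≡ d)
  factors-regular i = valency c i x₀ , d*k≡n-1 , λ x → valency-vertexIndependent i x x₀
    where
    x₀ = proj₁ (onto i)
    d*k≡n-1 : valency c i x₀ * k ≡ n ∸ 1
    d*k≡n-1 = begin
      valency c i x₀ * k            ≡⟨ *-comm (valency c i x₀) k ⟩
      k * valency c i x₀            ≡⟨ ∑-const k _ ⟨
      ∑[ j < k ] valency c i x₀     ≡⟨ sum-cong-≗ (λ j → valency-colourIndependent i j x₀) ⟩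
      ∑[ j < k ] valency c j x₀     ≡⟨ ∑-valency x₀ ⟩
      n ∸ 1                         ∎

proposition4p2 : (n k : ℕ) (M G : List (Map n)) (c : Fin n → Fin n → Fin k) →
    IsHomogeneousFactorisation n k M G c →
    EdgeTransitiveOnFactors M c →
    TwoTransitive G →
    2 ∣ order M →
    ((∀ (x y : Fin n) → x ≢ y → SelfPaired M (x , y)) ×
     Σ (Fin k → Fin n × Fin n) λ r →
       OrbitalTransversal M r ×
       (∀ (x y : Fin n) → x ≢ y → (i : Fin k) →
          (c x y ≡ i → SameOrbital M (r i) (x , y)) ×
          (SameOrbital M (r i) (x , y) → c x y ≡ i))) ×
    (∀ (i : Fin k) → ArcTransitive M c i ×
       Σ ℕ λ d → (d * k ≡ n ∸ 1) × (∀ (x : Fin n) → valency c i x ≡ d))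
proposition4p2 n k M G c hf edgeTrans 2-trans 2∣|M| =
  ( allSelfPaired
  , representative
  , orbitalTransversal edgeTrans allSelfPaired
  , λ x y x≢y i → colour≡⇒sameOrbital edgeTrans allSelfPaired i x≢y
                , sameOrbital⇒colour≡ edgeTrans allSelfPaired i )
  , λ i → arcTransitive edgeTrans allSelfPaired i , factors-regular i
  where
  open HomogeneousFactorisation hf
  allSelfPaired : ∀ x y → x ≢ y → SelfPaired M (x , y)
  allSelfPaired = evenOrder⇒allSelfPaired 2-trans 2∣|M|
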